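{- Let $r,s$ be positive integers with $r>s$, and let $n_1,\ldots,n_r$ be integers with $2\leq n_1\leq n_2\leq\cdots\leq n_r$. Then $$\mathrm{R}_{r,s}(P_{n_1},\ldots,P_{n_r})\geq \left\lfloor\frac{n_1-1}{2}\right\rfloor\left\lfloor\frac{r}{s}\right\rfloor+1.$$
   Context: $P_n$ denotes the path on $n$ vertices. For positive integers $r\ge s$ and graphs $G_1,\dots,G_r$, the set-coloring Ramsey number $\mathrm{R}_{r,s}(G_1,\dots,G_r)$ is the least $N\in\mathbb{N}$ such that for every coloring $\chi:E(K_N)\to\binom{[r]}{s}$ (each edge receives a set of $s$ distinct colors from $[r]$) there exist $i\in[r]$ and a copy of $G_i$ in $K_N$ with $i\in\chi(e)$ for every edge $e$ of this copy. -}

module Defs where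

open import Data.Nat using (ℕ; suc; _<_)
open import Data.Fin using (Fin; toℕ)
open import Data.Fin.Subset using (Subset; _∈_; ∣_∣)
open import Data.Product using (Σ; ∃; _×_)
open import Relation.Binary.PropositionalEquality using (_≡_; _≢_)
open import Function.Definitions using (Injective)

-- Encoded as a symmetric function on ordered pairs of vertices; the value
-- on an edge {a,b} (a ≢ b) is a subset of Fin r of size exactly s.
-- Diagonal values are irrelevant (never used by a path copy).
record SetColoring (r s N : ℕ) : Set where
  field
    χ    : Fin N → Fin N → Subset r
    symm : ∀ a b → χ a b ≡ χ b a
    size : ∀ a b → a ≢ b → ∣ χ a b ∣ ≡ s
open SetColoring public

MonoPath : ∀ {r s N} → SetColoring r s N → Fin r → ℕ → Set
MonoPath {N = N} C c n =
  Σ (Fin n → Fin N) λ v →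
    Injective _≡_ _≡_ v ×
    (∀ (k k' : Fin n) → toℕ k' ≡ suc (toℕ k) → c ∈ χ C (v k) (v k'))

-- N has the Ramsey property for (P_{ns 0}, …, P_{ns (r-1)}) with s-sets:
-- every set-coloring of K_N has, for some colour i, a copy of P_{ns i}
-- in colour i.  (Colour i ∈ Fin r corresponds to the paper's colour i+1.)
RamseyProp : (r s : ℕ) → (ℕ → ℕ) → ℕ → Set
RamseyProp r s ns N =
  ∀ (C : SetColoring r s N) → ∃ λ (i : Fin r) → MonoPath C i (ns (toℕ i))

-- Split the N ≤ ⌊(n₁-1)/2⌋·⌊r/s⌋ vertices into Q = ⌊r/s⌋ blocks of size
-- M = ⌊(n₁-1)/2⌋, and reserve Q disjoint s-sets of colours.  An edge between
-- blocks a and b receives the (a + b mod Q)-th s-set.  A colour lies in only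
-- one reserved s-set, so along a monochromatic path the block sums of
-- consecutive edges agree modulo Q and the blocks alternate between two
-- values.  Hence a monochromatic path stays inside two blocks and has at most
-- 2M < n₁ vertices.

module Submission where

open import Defs
open import Data.Nat using (ℕ; zero; suc; _≤_; _<_; _+_; _*_; _∸_; NonZero; z≤n; s≤s; z<s; s<s; >-nonZero)
open import Data.Nat.DivMod
open import Data.Nat.Divisibility using (n∣m*n)
open import Data.Nat.Properties
open import Data.Fin as Fin using (Fin; toℕ; fromℕ<; inject≤; quotient; remainder; combine)
open import Data.Fin.Properties
  using (toℕ-injective; toℕ-fromℕ<; toℕ<n; fromℕ<-cong; fromℕ<-injective;
         inject≤-injective; combine-remQuot; combine-injective; injective⇒≤)
open import Data.Fin.Subset using (Subset; _∈_; ∣_∣; inside; outside)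
open import Data.Vec using ([]; _∷_; here; there)
open import Data.Product using (_×_; _,_; proj₂)
open import Function.Definitions using (Injective)
open import Relation.Binary.PropositionalEquality

interval : ∀ {r} → ℕ → ℕ → Subset r
interval {zero}  _       _       = []
interval {suc r} (suc a) k       = outside ∷ interval a k
interval {suc r} zero    zero    = outside ∷ interval zero zero
interval {suc r} zero    (suc k) = inside ∷ interval zero k

∣interval∣≡k : ∀ {r} a k → a + k ≤ r → ∣ interval {r} a k ∣ ≡ k
∣interval∣≡k {zero}  zero    zero    _           = refl
∣interval∣≡k {suc r} (suc a) k       (s≤s a+k≤r) = ∣interval∣≡k a k a+k≤r
∣interval∣≡k {suc r} zero    zero    _           = ∣interval∣≡k {r} zero zero z≤n
∣interval∣≡k {suc r} zero    (suc k) (s≤s k≤r)   = cong suc (∣interval∣≡k {r} zero k k≤r)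

x∈interval⁻ : ∀ {r} a k (x : Fin r) → x ∈ interval a k → a ≤ toℕ x × toℕ x < a + k
x∈interval⁻ (suc a) k       (Fin.suc x) (there x∈) with a≤x , x<a+k ← x∈interval⁻ a k x x∈ =
  s≤s a≤x , s≤s x<a+k
x∈interval⁻ zero    zero    (Fin.suc x) (there x∈) with () ← proj₂ (x∈interval⁻ zero zero x x∈)
x∈interval⁻ zero    (suc k) Fin.zero    here       = z≤n , s≤s z≤n
x∈interval⁻ zero    (suc k) (Fin.suc x) (there x∈) = z≤n , s≤s (proj₂ (x∈interval⁻ zero k x x∈))

q*n≤m<q*n+n⇒m/n≡q : ∀ {m} n q .⦃ _ : NonZero n ⦄ → q * n ≤ m → m < q * n + n → m / n ≡ q
q*n≤m<q*n+n⇒m/n≡q {m} n q lo hi = begin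
  m / n                  ≡⟨ /-congˡ (m+[n∸m]≡n lo) ⟨
  (q * n + d) / n        ≡⟨ +-distrib-/-∣ˡ d (n∣m*n q) ⟩
  q * n / n + d / n      ≡⟨ cong₂ _+_ (m*n/n≡m q n) (m<n⇒m/n≡0 (m<n+o⇒m∸n<o m (q * n) hi)) ⟩
  q + 0                  ≡⟨ +-identityʳ q ⟩
  q                      ∎
  where
    open ≡-Reasoning
    d : ℕ
    d = m ∸ q * n

[m%n+o]%n≡[m+o]%n : ∀ m o n .⦃ _ : NonZero n ⦄ → (m % n + o) % n ≡ (m + o) % n
[m%n+o]%n≡[m+o]%n m o n = begin
  (m % n + o) % n          ≡⟨ %-distribˡ-+ (m % n) o n ⟩
  (m % n % n + o % n) % n  ≡⟨ cong (λ z → (z + o % n) % n) (m%n%n≡m%n m n) ⟩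
  (m % n + o % n) % n      ≡⟨ %-distribˡ-+ m o n ⟨
  (m + o) % n              ∎
  where open ≡-Reasoning

+-%-cancelˡ : ∀ {n} .⦃ _ : NonZero n ⦄ a {x y} → a ≤ n → x < n → y < n →
              (a + x) % n ≡ (a + y) % n → x ≡ y
+-%-cancelˡ {n} a {x} {y} a≤n x<n y<n eq = begin
  x                           ≡⟨ subtract-a x<n ⟨
  ((a + x) % n + (n ∸ a)) % n ≡⟨ cong (λ z → (z + (n ∸ a)) % n) eq ⟩
  ((a + y) % n + (n ∸ a)) % n ≡⟨ subtract-a y<n ⟩
  y                           ∎
  where
    open ≡-Reasoning
    subtract-a : ∀ {z} → z < n → ((a + z) % n + (n ∸ a)) % n ≡ z
    subtract-a {z} z<n = begin
      ((a + z) % n + (n ∸ a)) % n ≡⟨ [m%n+o]%n≡[m+o]%n (a + z) (n ∸ a) n ⟩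
      (a + z + (n ∸ a)) % n       ≡⟨ %-congˡ (begin
        a + z + (n ∸ a)   ≡⟨ cong (_+ (n ∸ a)) (+-comm a z) ⟩
        z + a + (n ∸ a)   ≡⟨ +-assoc z a (n ∸ a) ⟩
        z + (a + (n ∸ a)) ≡⟨ cong (z +_) (m+[n∸m]≡n a≤n) ⟩
        z + n             ∎) ⟩
      (z + n) % n                 ≡⟨ [m+n]%n≡m%n z n ⟩
      z % n                       ≡⟨ m<n⇒m%n≡m z<n ⟩
      z                           ∎

module _ {a} {A : Set a} {n} (f : Fin n → A)
         (f-2-periodic : ∀ i j → toℕ j ≡ 2 + toℕ i → f i ≡ f j) where

  private
    parityRep : Fin n → Fin n
    parityRep i = fromℕ< (≤-<-trans (m%n≤m (toℕ i) 2) (toℕ<n i))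

    parityRep-small : ∀ i → toℕ i < 2 → parityRep i ≡ i
    parityRep-small i i<2 = toℕ-injective (trans (toℕ-fromℕ< _) (m<n⇒m%n≡m i<2))

    f≡f∘parityRep : ∀ k (i : Fin n) → toℕ i ≡ k → f i ≡ f (parityRep i)
    f≡f∘parityRep zero          i i≡0 = cong f (sym (parityRep-small i (subst (_< 2) (sym i≡0) z<s)))
    f≡f∘parityRep (suc zero)    i i≡1 = cong f (sym (parityRep-small i (subst (_< 2) (sym i≡1) (s<s z<s))))
    f≡f∘parityRep (suc (suc k)) i i≡2+k = begin
      f i              ≡⟨ f-2-periodic i′ i (trans i≡2+k (cong (2 +_) (sym i′≡k))) ⟨
      f i′             ≡⟨ f≡f∘parityRep k i′ i′≡k ⟩
      -- (2 + k) % 2 and k % 2 are definitionally equal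
      f (parityRep i′) ≡⟨ cong f (fromℕ<-cong _ _ (trans (cong (_% 2) i′≡k) (cong (_% 2) (sym i≡2+k))) _ _) ⟩
      f (parityRep i)  ∎
      where
        open ≡-Reasoning
        i′ : Fin n
        i′ = fromℕ< (≤-<-trans (m≤n+m k 2) (subst (_< n) i≡2+k (toℕ<n i)))
        i′≡k : toℕ i′ ≡ k
        i′≡k = toℕ-fromℕ< _

  2-periodic⇒parity-invariant : ∀ i j → toℕ i % 2 ≡ toℕ j % 2 → f i ≡ f j
  2-periodic⇒parity-invariant i j i≡j = begin
    f i              ≡⟨ f≡f∘parityRep (toℕ i) i refl ⟩
    f (parityRep i)  ≡⟨ cong f (fromℕ<-cong _ _ i≡j _ _) ⟩
    f (parityRep j)  ≡⟨ f≡f∘parityRep (toℕ j) j refl ⟨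
    f j              ∎
    where open ≡-Reasoning

module BlockColouring (r s Q M N : ℕ) ⦃ _ : NonZero s ⦄ ⦃ _ : NonZero Q ⦄
                      (Q*s≤r : Q * s ≤ r) (N≤Q*M : N ≤ Q * M) where

  block : Fin N → Fin Q
  block v = quotient M (inject≤ v N≤Q*M)

  slot : Fin N → Fin M
  slot v = remainder {Q} M (inject≤ v N≤Q*M)

  block-slot-injective : ∀ u v → block u ≡ block v → slot u ≡ slot v → u ≡ v
  block-slot-injective u v bu≡bv su≡sv = inject≤-injective _ _ u v (begin
    inject≤ u N≤Q*M                       ≡⟨ combine-remQuot {Q} M (inject≤ u N≤Q*M) ⟨
    combine (block u) (slot u)            ≡⟨ cong₂ combine bu≡bv su≡sv ⟩
    combine (block v) (slot v)            ≡⟨ combine-remQuot {Q} M (inject≤ v N≤Q*M) ⟩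
    inject≤ v N≤Q*M                       ∎)
    where open ≡-Reasoning

  edgeClass : Fin N → Fin N → ℕ
  edgeClass u v = (toℕ (block u) + toℕ (block v)) % Q

  colouring : SetColoring r s N
  colouring = record
    { χ    = λ u v → interval (edgeClass u v * s) s
    ; symm = λ u v → cong (λ t → interval (t % Q * s) s) (+-comm (toℕ (block u)) (toℕ (block v)))
    ; size = λ u v _ → ∣interval∣≡k (edgeClass u v * s) s (begin
        edgeClass u v * s + s  ≡⟨ +-comm (edgeClass u v * s) s ⟩
        suc (edgeClass u v) * s ≤⟨ *-monoˡ-≤ s (m%n<n _ Q) ⟩
        Q * s                  ≤⟨ Q*s≤r ⟩
        r                      ∎)
    }
    where open ≤-Reasoning

  edgeClass-colour : ∀ c u v → c ∈ χ colouring u v → edgeClass u v ≡ toℕ c / s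
  edgeClass-colour c u v c∈ with lo , hi ← x∈interval⁻ (edgeClass u v * s) s c c∈ =
    sym (q*n≤m<q*n+n⇒m/n≡q s (edgeClass u v) lo hi)

  monoPath-length : ∀ c n → MonoPath colouring c n → n ≤ 2 * M
  monoPath-length c n (v , v-injective , v-edge) = injective⇒≤ code-injective
    where
      β : Fin n → ℕ
      β k = toℕ (block (v k))

      β-2-periodic : ∀ i j → toℕ j ≡ 2 + toℕ i → β i ≡ β j
      β-2-periodic i j j≡2+i = +-%-cancelˡ (β m) (<⇒≤ (toℕ<n (block (v m))))
        (toℕ<n (block (v i))) (toℕ<n (block (v j))) (begin
          (β m + β i) % Q  ≡⟨ cong (_% Q) (+-comm (β m) (β i)) ⟩
          edgeClass (v i) (v m) ≡⟨ edgeClass-colour c _ _ (v-edge i m m≡1+i) ⟩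
          toℕ c / s        ≡⟨ edgeClass-colour c _ _ (v-edge m j (trans j≡2+i (cong suc (sym m≡1+i)))) ⟨
          (β m + β j) % Q  ∎)
        where
          open ≡-Reasoning
          m : Fin n
          m = fromℕ< (≤-<-trans (n≤1+n (suc (toℕ i))) (subst (_< n) j≡2+i (toℕ<n j)))
          m≡1+i : toℕ m ≡ suc (toℕ i)
          m≡1+i = toℕ-fromℕ< _

      code : Fin n → Fin (2 * M)
      code k = combine (toℕ k mod 2) (slot (v k))

      code-injective : Injective _≡_ _≡_ code
      code-injective {i} {j} eq with parity≡ , slot≡ ← combine-injective _ _ _ _ eq =
        v-injective (block-slot-injective (v i) (v j) (toℕ-injective block≡) slot≡)
        where
          block≡ : β i ≡ β j
          block≡ = 2-periodic⇒parity-invariant β β-2-periodic i j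
                     (fromℕ<-injective _ _ _ _ parity≡)

2*[[n∸1]/2]<n : ∀ n → 1 ≤ n → 2 * ((n ∸ 1) / 2) < n
2*[[n∸1]/2]<n (suc k) _ = s≤s (≤-trans (≤-reflexive (*-comm 2 (k / 2))) (m/n*n≤m k 2))

theorem2p7 : (r s : ℕ) → ⦃ _ : NonZero s ⦄ → s < r →
    (ns : ℕ → ℕ) →
    2 ≤ ns 0 →
    (∀ i j → i ≤ j → j < r → ns i ≤ ns j) →
    ∀ N → RamseyProp r s ns N →
    ((ns 0 ∸ 1) / 2) * (r / s) + 1 ≤ N
theorem2p7 r s s<r ns 2≤n₀ ns-mono N ramsey = ≮⇒≥ λ N<M*Q+1 →
  let N≤Q*M : N ≤ Q * M
      N≤Q*M = subst (N ≤_) (*-comm M Q) (m<1+n⇒m≤n (subst (N <_) (+-comm (M * Q) 1) N<M*Q+1))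
      open BlockColouring r s Q M N (m/n*n≤m r s) N≤Q*M
      (i , path) = ramsey colouring
  in <⇒≱ (2*[[n∸1]/2]<n (ns 0) (<⇒≤ 2≤n₀))
         (≤-trans (ns-mono 0 (toℕ i) z≤n (toℕ<n i)) (monoPath-length i (ns (toℕ i)) path))
  where
    M Q : ℕ
    M = (ns 0 ∸ 1) / 2
    Q = r / s
    instance
      Q≢0 : NonZero Q
      Q≢0 = >-nonZero (m≥n⇒m/n>0 (<⇒≤ s<r))
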